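{- Let $L=(S,A,\to)$ be a labelled transition system and $R\subseteq S\times S$. Then: $R$ is a weak bisimulation iff it is an $(o,o)$-generic bisimulation; $R$ is a delay bisimulation iff it is an $(o,b)$-generic bisimulation; $R$ is an $\eta$-bisimulation iff it is a $(b,o)$-generic bisimulation; $R$ is a branching bisimulation iff it is a $(b,b)$-generic bisimulation.
   Context: LTS $L=(S,A,\to)$: states $S$, actions $A$ containing the internal action $\tau$, $\to\subseteq S\times A\times S$ written $s\xrightarrow{a}t$; $\twoheadrightarrow$ is the reflexive-transitive closure of $\xrightarrow{\tau}$. In each of the following, $R$ is a symmetric relation and the condition is: whenever $s\,R\,t$ and $s\xrightarrow{a}s'$, either $a=\tau$ and $s'\,R\,t$, or [the stated alternative]. Weak bisimulation: there exist $t_1,t_2,t'$ with $t\twoheadrightarrow t_1\xrightarrow{a}t_2\twoheadrightarrow t'$ and $s'\,R\,t'$. Delay bisimulation: there exist $t_1,t'$ with $t\twoheadrightarrow t_1\xrightarrow{a}t'$ and $s'\,R\,t'$. $\eta$-bisimulation: there exist $t_1,t_2,t'$ with $t\twoheadrightarrow t_1\xrightarrow{a}t_2\twoheadrightarrow t'$, $s\,R\,t_1$ and $s'\,R\,t'$. Branching bisimulation: there exist $t_1,t'$ with $t\twoheadrightarrow t_1\xrightarrow{a}t'$, $s\,R\,t_1$ and $s'\,R\,t'$. Generic: for $R\subseteq S\times S$ and $s,s',t$, $s\twoheadrightarrow_{o,R,t}s'$ iff $s\twoheadrightarrow s'$; $s\twoheadrightarrow_{b,R,t}s'$ iff $s\twoheadrightarrow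 s'$, $t\,R\,s$ and $t\,R\,s'$. For $x,y\in\{o,b\}$, a symmetric $R$ is an $(x,y)$-generic bisimulation if whenever $s\,R\,t$ and $s\xrightarrow{a}s'$, either $a=\tau$ and $s'\,R\,t$, or there exist $t_1,t_2,t'$ with $t\twoheadrightarrow_{x,R,s}t_1\xrightarrow{a}t_2\twoheadrightarrow_{y,R,s'}t'$ and $s'\,R\,t'$. -}

module Defs where

open import Level using (Level; _⊔_; suc)
open import Data.Product using (Σ; ∃; _×_; _,_)
open import Data.Sum using (_⊎_)
open import Relation.Binary.PropositionalEquality using (_≡_)
open import Relation.Binary.Core using (Rel)
open import Relation.Binary.Definitions using (Symmetric)
open import Relation.Binary.Construct.Closure.ReflexiveTransitive using (Star)

record LTS (s a t : Level) : Set (Level.suc (s ⊔ a ⊔ t)) where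
  field
    S    : Set s
    A    : Set a
    τ    : A
    _⟶[_]_ : S → A → S → Set t

module _ {s a t r : Level} (L : LTS s a t) where
  open LTS L

  τstep : Rel S t
  τstep x y = x ⟶[ τ ] y

  _↠_ : Rel S (s ⊔ t)
  _↠_ = Star τstep

  WeakBisim : Rel S r → Set (s ⊔ a ⊔ t ⊔ r)
  WeakBisim R = Symmetric R ×
    (∀ {x y x' α} → R x y → x ⟶[ α ] x' →
      (α ≡ τ × R x' y) ⊎
      (∃ λ y₁ → ∃ λ y₂ → ∃ λ y' →
        (y ↠ y₁) × (y₁ ⟶[ α ] y₂) × (y₂ ↠ y') × R x' y'))

  DelayBisim : Rel S r → Set (s ⊔ a ⊔ t ⊔ r)
  DelayBisim R = Symmetric R ×
    (∀ {x y x' α} → R x y → x ⟶[ α ] x' →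
      (α ≡ τ × R x' y) ⊎
      (∃ λ y₁ → ∃ λ y' →
        (y ↠ y₁) × (y₁ ⟶[ α ] y') × R x' y'))

  EtaBisim : Rel S r → Set (s ⊔ a ⊔ t ⊔ r)
  EtaBisim R = Symmetric R ×
    (∀ {x y x' α} → R x y → x ⟶[ α ] x' →
      (α ≡ τ × R x' y) ⊎
      (∃ λ y₁ → ∃ λ y₂ → ∃ λ y' →
        (y ↠ y₁) × (y₁ ⟶[ α ] y₂) × (y₂ ↠ y') × R x y₁ × R x' y'))

  BranchingBisim : Rel S r → Set (s ⊔ a ⊔ t ⊔ r)
  BranchingBisim R = Symmetric R ×
    (∀ {x y x' α} → R x y → x ⟶[ α ] x' →
      (α ≡ τ × R x' y) ⊎
      (∃ λ y₁ → ∃ λ y' →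
        (y ↠ y₁) × (y₁ ⟶[ α ] y') × R x y₁ × R x' y'))

  data Mode : Set where
    o b : Mode

  genSteps : Mode → Rel S r → S → S → S → Set (s ⊔ t ⊔ r)
  genSteps o R u x y = Level.Lift (s ⊔ t ⊔ r) (x ↠ y)
  genSteps b R u x y = (x ↠ y) × R u x × R u y

  GenericBisim : Mode → Mode → Rel S r → Set (s ⊔ a ⊔ t ⊔ r)
  GenericBisim m n R = Symmetric R ×
    (∀ {x y x' α} → R x y → x ⟶[ α ] x' →
      (α ≡ τ × R x' y) ⊎
      (∃ λ y₁ → ∃ λ y₂ → ∃ λ y' →
        genSteps m R x y y₁ × (y₁ ⟶[ α ] y₂) × genSteps n R x' y₂ y' × R x' y'))

-- Each of the four classical notions differs from its generic counterpart only
-- in how the matching transition sequence is written down.  A leading b-segment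
-- y ↠ y₁ starting from a state related to x records exactly the extra condition
-- R x y₁ of the η- and branching variants.  A trailing b-segment y₂ ↠ y' forces
-- R x' y₂, so it may be taken empty, which is the delay and branching condition
-- that the matching transition ends in a related state.
module Submission where

open import Defs hiding (_↠_)
import Defs
open import Level using (Level; _⊔_; lift; lower)
open import Data.Product using (∃; _×_; _,_)
open import Data.Sum using (_⊎_; map₂)
open import Function.Bundles using (_⇔_; mk⇔)
open import Relation.Binary.Core using (Rel)
open import Relation.Binary.Definitions using (Symmetric)
open import Relation.Binary.PropositionalEquality using (_≡_)
open import Relation.Binary.Construct.Closure.ReflexiveTransitive using (ε)

module _ {s a t r : Level} (L : LTS s a t) (R : Rel (LTS.S L) r) where
  open LTS L

  -- Defs._↠_ does not mention, hence cannot infer, its level parameter r.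
  private
    _↠_ : Rel S (s ⊔ t)
    _↠_ = Defs._↠_ {r = r} L

  -- Each bisimulation notion of Defs is definitionally Matching M for the
  -- matching condition M of the same name below.
  Matching : (S → S → S → A → Set (s ⊔ t ⊔ r)) → Set (s ⊔ a ⊔ t ⊔ r)
  Matching M = Symmetric R ×
    (∀ {x y x' α} → R x y → x ⟶[ α ] x' → (α ≡ τ × R x' y) ⊎ M x y x' α)

  Matching-mono : {M N : S → S → S → A → Set (s ⊔ t ⊔ r)} →
    (∀ {x y x' α} → R x y → M x y x' α → N x y x' α) →
    Matching M → Matching N
  Matching-mono M⇒N (sym , match) = sym , λ xRy x⟶x' → map₂ (M⇒N xRy) (match xRy x⟶x')

  Matching-cong : {M N : S → S → S → A → Set (s ⊔ t ⊔ r)} →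
    (∀ {x y x' α} → R x y → M x y x' α → N x y x' α) →
    (∀ {x y x' α} → R x y → N x y x' α → M x y x' α) →
    Matching M ⇔ Matching N
  Matching-cong M⇒N N⇒M = mk⇔ (Matching-mono M⇒N) (Matching-mono N⇒M)

  WeakMatch DelayMatch EtaMatch BranchingMatch : S → S → S → A → Set (s ⊔ t ⊔ r)
  WeakMatch x y x' α = ∃ λ y₁ → ∃ λ y₂ → ∃ λ y' →
    (y ↠ y₁) × (y₁ ⟶[ α ] y₂) × (y₂ ↠ y') × R x' y'
  DelayMatch x y x' α = ∃ λ y₁ → ∃ λ y' →
    (y ↠ y₁) × (y₁ ⟶[ α ] y') × R x' y'
  EtaMatch x y x' α = ∃ λ y₁ → ∃ λ y₂ → ∃ λ y' →
    (y ↠ y₁) × (y₁ ⟶[ α ] y₂) × (y₂ ↠ y') × R x y₁ × R x' y'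
  BranchingMatch x y x' α = ∃ λ y₁ → ∃ λ y' →
    (y ↠ y₁) × (y₁ ⟶[ α ] y') × R x y₁ × R x' y'

  GenericMatch : Mode L → Mode L → S → S → S → A → Set (s ⊔ t ⊔ r)
  GenericMatch m n x y x' α = ∃ λ y₁ → ∃ λ y₂ → ∃ λ y' →
    genSteps L m R x y y₁ × (y₁ ⟶[ α ] y₂) × genSteps L n R x' y₂ y' × R x' y'

  genSteps-b-refl : ∀ {u x} → R u x → genSteps L b R u x x
  genSteps-b-refl uRx = ε , uRx , uRx

  weak⇒generic-oo : ∀ {x y x' α} → R x y → WeakMatch x y x' α → GenericMatch o o x y x' α
  weak⇒generic-oo _ (y₁ , y₂ , y' , y↠y₁ , step , y₂↠y' , x'Ry') =
    y₁ , y₂ , y' , lift y↠y₁ , step , lift y₂↠y' , x'Ry'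

  generic-oo⇒weak : ∀ {x y x' α} → R x y → GenericMatch o o x y x' α → WeakMatch x y x' α
  generic-oo⇒weak _ (y₁ , y₂ , y' , y↠y₁ , step , y₂↠y' , x'Ry') =
    y₁ , y₂ , y' , lower y↠y₁ , step , lower y₂↠y' , x'Ry'

  delay⇒generic-ob : ∀ {x y x' α} → R x y → DelayMatch x y x' α → GenericMatch o b x y x' α
  delay⇒generic-ob _ (y₁ , y' , y↠y₁ , step , x'Ry') =
    y₁ , y' , y' , lift y↠y₁ , step , genSteps-b-refl x'Ry' , x'Ry'

  generic-ob⇒delay : ∀ {x y x' α} → R x y → GenericMatch o b x y x' α → DelayMatch x y x' α
  generic-ob⇒delay _ (y₁ , y₂ , _ , y↠y₁ , step , (_ , x'Ry₂ , _) , _) =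
    y₁ , y₂ , lower y↠y₁ , step , x'Ry₂

  eta⇒generic-bo : ∀ {x y x' α} → R x y → EtaMatch x y x' α → GenericMatch b o x y x' α
  eta⇒generic-bo xRy (y₁ , y₂ , y' , y↠y₁ , step , y₂↠y' , xRy₁ , x'Ry') =
    y₁ , y₂ , y' , (y↠y₁ , xRy , xRy₁) , step , lift y₂↠y' , x'Ry'

  generic-bo⇒eta : ∀ {x y x' α} → R x y → GenericMatch b o x y x' α → EtaMatch x y x' α
  generic-bo⇒eta _ (y₁ , y₂ , y' , (y↠y₁ , _ , xRy₁) , step , y₂↠y' , x'Ry') =
    y₁ , y₂ , y' , y↠y₁ , step , lower y₂↠y' , xRy₁ , x'Ry'

  branching⇒generic-bb : ∀ {x y x' α} → R x y → BranchingMatch x y x' α → GenericMatch b b x y x' α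
  branching⇒generic-bb xRy (y₁ , y' , y↠y₁ , step , xRy₁ , x'Ry') =
    y₁ , y' , y' , (y↠y₁ , xRy , xRy₁) , step , genSteps-b-refl x'Ry' , x'Ry'

  generic-bb⇒branching : ∀ {x y x' α} → R x y → GenericMatch b b x y x' α → BranchingMatch x y x' α
  generic-bb⇒branching _ (y₁ , y₂ , _ , (y↠y₁ , _ , xRy₁) , step , (_ , x'Ry₂ , _) , _) =
    y₁ , y₂ , y↠y₁ , step , xRy₁ , x'Ry₂

proposition4p6 : {s a t r : Level} (L : LTS s a t) (R : Rel (LTS.S L) r) →
    (WeakBisim L R ⇔ GenericBisim L o o R) ×
    (DelayBisim L R ⇔ GenericBisim L o b R) ×
    (EtaBisim L R ⇔ GenericBisim L b o R) ×
    (BranchingBisim L R ⇔ GenericBisim L b b R)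
proposition4p6 L R =
  Matching-cong L R (weak⇒generic-oo L R) (generic-oo⇒weak L R) ,
  Matching-cong L R (delay⇒generic-ob L R) (generic-ob⇒delay L R) ,
  Matching-cong L R (eta⇒generic-bo L R) (generic-bo⇒eta L R) ,
  Matching-cong L R (branching⇒generic-bb L R) (generic-bb⇒branching L R)
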